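{- Let $G=(V,E)$ be a finite directed graph and let $k$ be the number of non-empty minimal passages of $G$. Then $G$ has exactly $2^k$ passages and exactly $B_k$ passage partitionings, where $B_k$ is the $k$-th Bell number (the number of partitions of a $k$-element set, with $B_0=1$). Moreover, for every passage partitioning $\{P_1,\dots,P_n\}$ of $G$ we have $n\le k\le |E|$.
   Context: A directed graph is a pair $G=(V,E)$ with $E\subseteq V\times V$; finite means $V$ is finite. A set $P\subseteq E$ is a passage of $G$ if for every $(x,y)\in P$ and all $x',y'\in V$ with $(x,y')\in E$ and $(x',y)\in E$, we have $(x,y')\in P$ and $(x',y)\in P$ (the empty set and $E$ are passages). A passage $P$ is minimal if there is no non-empty passage $P'$ of $G$ with $P'\subsetneq P$. A passage partitioning of $G$ is a finite set $\mathcal P=\{P_1,\dots,P_n\}$ of non-empty passages of $G$ (with the $P_i$ distinct) such that $\bigcup_{i=1}^n P_i=E$ and $P_i\cap P_j=\emptyset$ for all $1\le i<j\le n$. -}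

module Defs where

open import Data.Nat using (ℕ; zero; suc; _+_; _*_)
open import Data.Fin using (Fin)
open import Data.Fin.Subset using (Subset; ∣_∣) renaming (_∈_ to _∈ₛ_)
open import Data.Vec using (Vec; lookup)
import Data.Vec as V
open import Data.List using (List; length)
open import Data.List.Membership.Propositional using (_∈_)
open import Data.List.Relation.Unary.Unique.Propositional using (Unique)
open import Data.List.Relation.Unary.All using (All)
open import Data.List.Relation.Unary.Any using (Any)
open import Data.List.Relation.Unary.AllPairs using (AllPairs)
open import Data.List.Relation.Binary.Permutation.Propositional using (_↭_)
open import Data.Product using (Σ; ∃; ∃-syntax; _×_)
open import Function.Bundles using (_⇔_)
open import Relation.Nullary using (¬_)
open import Relation.Binary.PropositionalEquality using (_≡_; _≢_)

-- A set of edges on the vertex set Fin n: an n×n Boolean adjacency matrix.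
-- Row x is the subset of out-neighbours y with (x , y) in the set.
EdgeSet : ℕ → Set
EdgeSet n = Vec (Subset n) n

-- A finite directed graph G = (Fin n, E) is given by its edge set E.

_,_∈ₑ_ : ∀ {n} → Fin n → Fin n → EdgeSet n → Set
x , y ∈ₑ P = y ∈ₛ lookup P x

infix 4 _,_∈ₑ_

_⊆ₑ_ : ∀ {n} → EdgeSet n → EdgeSet n → Set
P ⊆ₑ Q = ∀ x y → x , y ∈ₑ P → x , y ∈ₑ Q

edgeCount : ∀ {n} → EdgeSet n → ℕ
edgeCount E = V.sum (V.map ∣_∣ E)

NonEmpty : ∀ {n} → EdgeSet n → Set
NonEmpty P = ∃[ x ] ∃[ y ] (x , y ∈ₑ P)

IsPassage : ∀ {n} → EdgeSet n → EdgeSet n → Set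
IsPassage E P =
  P ⊆ₑ E ×
  (∀ x y x′ y′ → x , y ∈ₑ P → x , y′ ∈ₑ E → x′ , y ∈ₑ E →
     (x , y′ ∈ₑ P) × (x′ , y ∈ₑ P))

IsMinimalPassage : ∀ {n} → EdgeSet n → EdgeSet n → Set
IsMinimalPassage E P =
  IsPassage E P ×
  ¬ (∃[ P′ ] (IsPassage E P′ × NonEmpty P′ × P′ ⊆ₑ P × P′ ≢ P))

Disjoint : ∀ {n} → EdgeSet n → EdgeSet n → Set
Disjoint P Q = ∀ x y → ¬ ((x , y ∈ₑ P) × (x , y ∈ₑ Q))

IsPassagePartitioning : ∀ {n} → EdgeSet n → List (EdgeSet n) → Set
IsPassagePartitioning E Ps =
  Unique Ps ×
  All (λ P → IsPassage E P × NonEmpty P) Ps ×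
  (∀ x y → (x , y ∈ₑ E) ⇔ Any (λ P → x , y ∈ₑ P) Ps) ×
  AllPairs Disjoint Ps

HasCard : ∀ {n} → (EdgeSet n → Set) → ℕ → Set
HasCard {n} A m =
  Σ (List (EdgeSet n)) λ L →
    Unique L × (∀ P → (P ∈ L) ⇔ A P) × length L ≡ m

-- Exactly m finite sets of edge sets satisfy A, where a finite set is
-- represented by a list and two lists represent the same set iff they are
-- permutations of each other (A is only applied to duplicate-free lists here).
HasCardUpToPerm : ∀ {n} → (List (EdgeSet n) → Set) → ℕ → Set
HasCardUpToPerm {n} A m =
  Σ (List (List (EdgeSet n))) λ L →
    AllPairs (λ Ps Qs → ¬ (Ps ↭ Qs)) L ×
    All A L ×
    (∀ Ps → A Ps → Any (λ Qs → Ps ↭ Qs) L) ×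
    length L ≡ m

stirling2 : ℕ → ℕ → ℕ
stirling2 zero    zero    = 1
stirling2 zero    (suc k) = 0
stirling2 (suc n) zero    = 0
stirling2 (suc n) (suc k) = suc k * stirling2 n (suc k) + stirling2 n k

sumBelow : ℕ → (ℕ → ℕ) → ℕ
sumBelow zero    f = 0
sumBelow (suc m) f = sumBelow m f + f m

bell : ℕ → ℕ
bell n = sumBelow (suc n) (stirling2 n)

module Submission where

-- Call the non-empty minimal passages of E its atoms.  Passages are closed
-- under intersection and difference, so an atom A and a passage P satisfy
-- A ⊆ P or A ∩ P = ∅ (minimal-split), distinct atoms are disjoint, and every
-- edge lies in an atom, namely the passage it generates (module Generated).
-- Hence, with k atoms, the maps  union : Subset k → passages  and
-- atomsIn : passages → Subset k  are mutually inverse (module Atoms).  This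
-- gives 2 ^ k passages at once, and it turns passage partitionings into set
-- partitions of the k atoms, whose number up to reordering is the Bell number
-- B_k (bell-partitions, proved via the Stirling recurrence by listing the
-- partitions of Fin m into j blocks); a partition of Fin k has at most k
-- blocks.  Finally the atoms are k disjoint non-empty sets of edges, so
-- k ≤ |E| (disjoint-parts≤).

open import Defs
open import Data.Nat using (ℕ; zero; suc; _+_; _*_; _^_; _≤_; _<_; z≤n; s≤s)
import Data.Nat.Properties as ℕ
open import Data.Bool using (true; false)
import Data.Bool as Bool
open import Data.Fin using (Fin; zero; suc)
import Data.Fin.Properties as Fin
open import Data.Fin.Subset using (Subset; Nonempty; ∣_∣)
  renaming (_∈_ to _∈ₛ_; _⊆_ to _⊆ₛ_; _⊂_ to _⊂ₛ_; ⊥ to ∅)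
import Data.Fin.Subset.Properties as Sub
open import Data.Vec using (Vec; []; _∷_; lookup; tabulate)
import Data.Vec as V
import Data.Vec.Properties as VecP
open import Data.List using (List; []; _∷_; [_]; length; map; _++_; concatMap; filter)
import Data.List as List
import Data.List.Properties as ListP
open import Data.List.Membership.Propositional using (_∈_; _∉_; find; lose)
import Data.List.Membership.Propositional.Properties as Mem
open import Data.List.Relation.Unary.All as All using (All; []; _∷_)
import Data.List.Relation.Unary.All.Properties as AllP
open import Data.List.Relation.Unary.Any as Any using (Any; here; there)
import Data.List.Relation.Unary.Any.Properties as AnyP
open import Data.List.Relation.Unary.AllPairs as AllPairs using (AllPairs; []; _∷_)
import Data.List.Relation.Unary.AllPairs.Properties as AllPairsP
open import Data.List.Relation.Unary.Unique.Propositional using (Unique)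
import Data.List.Relation.Unary.Unique.Propositional.Properties as UniqueP
open import Data.List.Relation.Binary.BagAndSetEquality using (_∼[_]_; set; ∼bag⇒↭)
open import Data.List.Membership.Propositional.Properties.WithK using (unique∧set⇒bag)
open import Data.List.Relation.Binary.Permutation.Propositional using (_↭_; ↭-sym)
import Data.List.Relation.Binary.Permutation.Propositional.Properties as Perm
open import Data.Product using (Σ; ∃; ∃-syntax; _×_; _,_; proj₁; proj₂)
open import Data.Sum using (_⊎_; inj₁; inj₂)
open import Data.Empty using (⊥; ⊥-elim)
open import Function using (_∘_; id)
open import Function.Bundles using (_⇔_; mk⇔; Equivalence)
import Function.Properties.Equivalence as ⇔
open import Relation.Nullary using (¬_; Dec; yes; no; does)
open import Relation.Nullary.Decidable using (_×-dec_; _→-dec_; ¬?; decidable-stable; map′)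
open import Relation.Binary.PropositionalEquality
  using (_≡_; _≢_; refl; sym; trans; cong; cong₂; subst; subst₂; module ≡-Reasoning)

open Equivalence using (to; from)

AllPairs-mapWith : ∀ {A : Set} {Q : A → Set} {R S : A → A → Set} {xs} →
                   (∀ {x y} → Q x → Q y → R x y → S x y) → All Q xs → AllPairs R xs → AllPairs S xs
AllPairs-mapWith f []         []         = []
AllPairs-mapWith f (qx ∷ qxs) (rx ∷ rxs) =
  All.zipWith (λ (qy , r) → f qx qy r) (qxs , rx) ∷ AllPairs-mapWith f qxs rxs

set⇒↭ : ∀ {A : Set} {xs ys : List A} → Unique xs → Unique ys → xs ∼[ set ] ys → xs ↭ ys
set⇒↭ xs! ys! xs≈ys = ∼bag⇒↭ (unique∧set⇒bag xs! ys! xs≈ys)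

↭⇒set : ∀ {A : Set} {xs ys : List A} → xs ↭ ys → xs ∼[ set ] ys
↭⇒set xs↭ys = mk⇔ (Perm.∈-resp-↭ xs↭ys) (Perm.∈-resp-↭ (↭-sym xs↭ys))

CountUpToPerm : ∀ {B : Set} → (List B → Set) → ℕ → Set
CountUpToPerm {B} A c =
  Σ (List (List B)) λ L →
    AllPairs (λ xs ys → ¬ (xs ↭ ys)) L × All A L × (∀ xs → A xs → Any (xs ↭_) L) × length L ≡ c

count-transfer : ∀ {A B : Set} {QA : List A → Set} {QB : List B → Set} {c} (f : A → B) (g : B → A) →
  (∀ a → g (f a) ≡ a) → (∀ {xs} → QA xs → QB (map f xs)) →
  (∀ {ys} → QB ys → QA (map g ys) × map f (map g ys) ≡ ys) →
  CountUpToPerm QA c → CountUpToPerm QB c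
count-transfer f g g∘f fwd bwd (L , distinct , valid , complete , len) =
  map (map f) L ,
  AllPairsP.map⁺ (AllPairs.map (λ xs≉ys fxs↭fys → xs≉ys (unmap fxs↭fys)) distinct) ,
  AllP.map⁺ (All.map fwd valid) ,
  (λ ys QBys → let (QA-gys , f∘g≡) = bwd QBys in
     AnyP.map⁺ (Any.map (λ gys↭xs → subst (_↭ _) f∘g≡ (Perm.map⁺ f gys↭xs)) (complete (map g ys) QA-gys))) ,
  trans (ListP.length-map (map f) L) len
  where
  g∘f-map : ∀ xs → map g (map f xs) ≡ xs
  g∘f-map []       = refl
  g∘f-map (x ∷ xs) = cong₂ _∷_ (g∘f x) (g∘f-map xs)
  unmap : ∀ {xs ys} → map f xs ↭ map f ys → xs ↭ ys
  unmap {xs} {ys} fxs↭fys = subst₂ _↭_ (g∘f-map xs) (g∘f-map ys) (Perm.map⁺ g fxs↭fys)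

lookup-injective : ∀ {A : Set} {xs : List A} → Unique xs →
                   ∀ {i j} → List.lookup xs i ≡ List.lookup xs j → i ≡ j
lookup-injective {xs = x ∷ xs} (_ ∷ xs!) {zero}  {zero}  _  = refl
lookup-injective {xs = x ∷ xs} (x∉ ∷ _)  {zero}  {suc j} eq = ⊥-elim (All.lookup x∉ (Mem.∈-lookup j) eq)
lookup-injective {xs = x ∷ xs} (x∉ ∷ _)  {suc i} {zero}  eq = ⊥-elim (All.lookup x∉ (Mem.∈-lookup i) (sym eq))
lookup-injective {xs = x ∷ xs} (_ ∷ xs!) {suc i} {suc j} eq = cong suc (lookup-injective xs! eq)

subsetOf : ∀ {m} {R : Fin m → Set} → (∀ i → Dec (R i)) → Subset m
subsetOf {zero}  R? = []
subsetOf {suc m} R? = does (R? zero) ∷ subsetOf (R? ∘ suc)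

∈-subsetOf : ∀ {m} {R : Fin m → Set} (R? : ∀ i → Dec (R i)) i → i ∈ₛ subsetOf R? ⇔ R i
∈-subsetOf R? zero with R? zero
... | yes r = mk⇔ (λ _ → r) (λ _ → V.here)
... | no ¬r = mk⇔ (λ ()) (λ r → ⊥-elim (¬r r))
∈-subsetOf R? (suc i) =
  mk⇔ (λ { (V.there h) → to (∈-subsetOf (R? ∘ suc) i) h })
      (λ r → V.there (from (∈-subsetOf (R? ∘ suc) i) r))

edgesOf : ∀ {n} {R : Fin n → Fin n → Set} → (∀ x y → Dec (R x y)) → EdgeSet n
edgesOf R? = tabulate λ x → subsetOf (R? x)

∈-edgesOf : ∀ {n} {R : Fin n → Fin n → Set} (R? : ∀ x y → Dec (R x y)) x y →
            x , y ∈ₑ edgesOf R? ⇔ R x y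
∈-edgesOf R? x y rewrite VecP.lookup∘tabulate (λ x → subsetOf (R? x)) x = ∈-subsetOf (R? x) y

rows-antisym : ∀ {n r} {P Q : Vec (Subset n) r} →
               (∀ x → lookup P x ⊆ₛ lookup Q x) → (∀ x → lookup Q x ⊆ₛ lookup P x) → P ≡ Q
rows-antisym {P = []}    {[]}    _   _   = refl
rows-antisym {P = p ∷ P} {q ∷ Q} P⊆Q Q⊆P =
  cong₂ _∷_ (Sub.⊆-antisym (P⊆Q zero) (Q⊆P zero)) (rows-antisym (P⊆Q ∘ suc) (Q⊆P ∘ suc))

⊆ₑ-antisym : ∀ {n} {P Q : EdgeSet n} → P ⊆ₑ Q → Q ⊆ₑ P → P ≡ Q
⊆ₑ-antisym P⊆Q Q⊆P = rows-antisym (λ x → P⊆Q x _) (λ x → Q⊆P x _)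

_,_∈?_ : ∀ {n} (x y : Fin n) (P : EdgeSet n) → Dec (x , y ∈ₑ P)
x , y ∈? P = y Sub.∈? lookup P x

_⊆ₑ?_ : ∀ {n} (P Q : EdgeSet n) → Dec (P ⊆ₑ Q)
P ⊆ₑ? Q = Fin.all? λ x → Fin.all? λ y → (x , y ∈? P) →-dec (x , y ∈? Q)

nonEmpty? : ∀ {n} (P : EdgeSet n) → Dec (NonEmpty P)
nonEmpty? P = Fin.any? λ x → Fin.any? λ y → x , y ∈? P

isPassage? : ∀ {n} (E P : EdgeSet n) → Dec (IsPassage E P)
isPassage? E P = (P ⊆ₑ? E) ×-dec
  (Fin.all? λ x → Fin.all? λ y → Fin.all? λ x′ → Fin.all? λ y′ →
     (x , y ∈? P) →-dec ((x , y′ ∈? E) →-dec ((x′ , y ∈? E) →-dec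
       ((x , y′ ∈? P) ×-dec (x′ , y ∈? P)))))

anyRows? : ∀ {n r} {Q : Vec (Subset n) r → Set} → (∀ P → Dec (Q P)) → Dec (∃ Q)
anyRows? {r = zero}  Q? = map′ ([] ,_) (λ { ([] , q) → q }) (Q? [])
anyRows? {r = suc r} Q? =
  map′ (λ { (p , P , q) → p ∷ P , q }) (λ { (p ∷ P , q) → p , P , q })
       (Sub.anySubset? λ p → anyRows? λ P → Q? (p ∷ P))

allSubsets : (m : ℕ) → List (Subset m)
allSubsets zero    = [ [] ]
allSubsets (suc m) = map (true ∷_) (allSubsets m) ++ map (false ∷_) (allSubsets m)

∈-allSubsets : ∀ {m} (s : Subset m) → s ∈ allSubsets m
∈-allSubsets []          = here refl
∈-allSubsets (true ∷ s)  = Mem.∈-++⁺ˡ (Mem.∈-map⁺ (true ∷_) (∈-allSubsets s))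
∈-allSubsets (false ∷ s) = Mem.∈-++⁺ʳ _ (Mem.∈-map⁺ (false ∷_) (∈-allSubsets s))

allSubsets-unique : ∀ m → Unique (allSubsets m)
allSubsets-unique zero    = [] ∷ []
allSubsets-unique (suc m) =
  UniqueP.++⁺ (UniqueP.map⁺ VecP.∷-injectiveʳ (allSubsets-unique m))
              (UniqueP.map⁺ VecP.∷-injectiveʳ (allSubsets-unique m))
              λ { (t∈ , f∈) → heads-differ (Mem.∈-map⁻ (true ∷_) t∈) (Mem.∈-map⁻ (false ∷_) f∈) }
  where
  heads-differ : ∀ {v : Subset (suc m)} → ∃[ s ] (s ∈ allSubsets m × v ≡ true ∷ s) →
                 ∃[ s ] (s ∈ allSubsets m × v ≡ false ∷ s) → ⊥
  heads-differ (_ , _ , refl) (_ , _ , ())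

length-allSubsets : ∀ m → length (allSubsets m) ≡ 2 ^ m
length-allSubsets zero    = refl
length-allSubsets (suc m) = begin
  length (map (true ∷_) (allSubsets m) ++ map (false ∷_) (allSubsets m))
    ≡⟨ ListP.length-++ (map (true ∷_) (allSubsets m)) ⟩
  length (map (true ∷_) (allSubsets m)) + length (map (false ∷_) (allSubsets m))
    ≡⟨ cong₂ _+_ (ListP.length-map (true ∷_) (allSubsets m)) (ListP.length-map (false ∷_) (allSubsets m)) ⟩
  length (allSubsets m) + length (allSubsets m)
    ≡⟨ cong₂ _+_ (length-allSubsets m) (trans (length-allSubsets m) (sym (ℕ.+-identityʳ (2 ^ m)))) ⟩
  2 ^ m + (2 ^ m + 0) ∎
  where open ≡-Reasoning

infixl 25 _∩ₑ_ _∖ₑ_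

_∩ₑ_ : ∀ {n} → EdgeSet n → EdgeSet n → EdgeSet n
P ∩ₑ Q = edgesOf λ x y → (x , y ∈? P) ×-dec (x , y ∈? Q)

_∖ₑ_ : ∀ {n} → EdgeSet n → EdgeSet n → EdgeSet n
P ∖ₑ Q = edgesOf λ x y → (x , y ∈? P) ×-dec ¬? (x , y ∈? Q)

∈-∩ₑ : ∀ {n} (P Q : EdgeSet n) {x y} → x , y ∈ₑ P ∩ₑ Q ⇔ (x , y ∈ₑ P × x , y ∈ₑ Q)
∈-∩ₑ P Q {x} {y} = ∈-edgesOf _ x y

∈-∖ₑ : ∀ {n} (P Q : EdgeSet n) {x y} → x , y ∈ₑ P ∖ₑ Q ⇔ (x , y ∈ₑ P × ¬ x , y ∈ₑ Q)
∈-∖ₑ P Q {x} {y} = ∈-edgesOf _ x y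

module _ {n} {E : EdgeSet n} where

  whole-passage : IsPassage E E
  whole-passage = (λ _ _ e → e) , λ _ _ _ _ _ e₁ e₂ → e₁ , e₂

  ∩-passage : ∀ {P Q} → IsPassage E P → IsPassage E Q → IsPassage E (P ∩ₑ Q)
  ∩-passage {P} {Q} (P⊆E , P-closed) (Q⊆E , Q-closed) =
    (λ x y e → P⊆E x y (proj₁ (to (∈-∩ₑ P Q) e))) ,
    λ x y x′ y′ e e₁ e₂ →
      let (eP , eQ) = to (∈-∩ₑ P Q) e
          (p₁ , p₂) = P-closed x y x′ y′ eP e₁ e₂
          (q₁ , q₂) = Q-closed x y x′ y′ eQ e₁ e₂
      in from (∈-∩ₑ P Q) (p₁ , q₁) , from (∈-∩ₑ P Q) (p₂ , q₂)

  -- ... and under difference: an edge adjacent to an edge outside the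
  -- passage Q is itself outside Q.
  ∖-passage : ∀ {P Q} → IsPassage E P → IsPassage E Q → IsPassage E (P ∖ₑ Q)
  ∖-passage {P} {Q} (P⊆E , P-closed) (_ , Q-closed) =
    (λ x y e → P⊆E x y (proj₁ (to (∈-∖ₑ P Q) e))) ,
    λ x y x′ y′ e e₁ e₂ →
      let (eP , e∉Q) = to (∈-∖ₑ P Q) e
          (p₁ , p₂) = P-closed x y x′ y′ eP e₁ e₂
          eE = P⊆E x y eP
      in from (∈-∖ₑ P Q) (p₁ , λ q → e∉Q (proj₁ (Q-closed x y′ x y q eE e₁))) ,
         from (∈-∖ₑ P Q) (p₂ , λ q → e∉Q (proj₂ (Q-closed x′ y x y q e₂ eE)))

-- The passage generated by an edge (x₀ , y₀): the intersection of all
-- passages containing it, i.e. the edges that no passage through (x₀ , y₀)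
-- misses (decidable since edge sets can be searched).
module Generated {n} (E : EdgeSet n) (x₀ y₀ : Fin n) where

  PassageThrough : EdgeSet n → Set
  PassageThrough P = IsPassage E P × x₀ , y₀ ∈ₑ P

  generated : EdgeSet n
  generated = edgesOf λ a b → ¬? (anyRows? λ P →
                 (isPassage? E P ×-dec (x₀ , y₀ ∈? P)) ×-dec ¬? (a , b ∈? P))

  ∈-generated : ∀ {a b} → a , b ∈ₑ generated ⇔ (∀ P → PassageThrough P → a , b ∈ₑ P)
  ∈-generated {a} {b} = mk⇔
    (λ e P P-through → decidable-stable (a , b ∈? P) λ e∉P →
       to (∈-edgesOf _ a b) e (P , P-through , e∉P))
    (λ in-all → from (∈-edgesOf _ a b) λ { (P , P-through , e∉P) → e∉P (in-all P P-through) })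

  module _ (x₀y₀∈E : x₀ , y₀ ∈ₑ E) where

    generated-passage : IsPassage E generated
    generated-passage =
      (λ x y e → to ∈-generated e E (whole-passage {E = E} , x₀y₀∈E)) ,
      λ x y x′ y′ e e₁ e₂ →
        from ∈-generated (λ P P-through →
          proj₁ (proj₂ (proj₁ P-through) x y x′ y′ (to ∈-generated e P P-through) e₁ e₂)) ,
        from ∈-generated (λ P P-through →
          proj₂ (proj₂ (proj₁ P-through) x y x′ y′ (to ∈-generated e P P-through) e₁ e₂))

    x₀y₀∈generated : x₀ , y₀ ∈ₑ generated
    x₀y₀∈generated = from ∈-generated λ P P-through → proj₂ P-through

    -- A non-empty passage P′ ⊆ generated either contains (x₀ , y₀), and then
    -- equals generated, or it does not, and then generated ∖ P′ is a smaller
    -- passage through (x₀ , y₀), which is absurd.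
    generated-minimal : IsMinimalPassage E generated
    generated-minimal = generated-passage , λ { (P′ , P′-passage , (a , b , ab∈P′) , P′⊆gen , P′≢gen) →
      no-smaller P′-passage a b ab∈P′ P′⊆gen P′≢gen }
      where
      no-smaller : ∀ {P′} → IsPassage E P′ → ∀ a b → a , b ∈ₑ P′ → P′ ⊆ₑ generated → P′ ≢ generated → ⊥
      no-smaller {P′} P′-passage a b ab∈P′ P′⊆gen P′≢gen with x₀ , y₀ ∈? P′
      ... | yes x₀y₀∈P′ = P′≢gen (⊆ₑ-antisym P′⊆gen λ x y e → to ∈-generated e P′ (P′-passage , x₀y₀∈P′))
      ... | no  x₀y₀∉P′ = proj₂ (to (∈-∖ₑ generated P′) (to ∈-generated (P′⊆gen a b ab∈P′) (generated ∖ₑ P′)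
                             (∖-passage {E = E} {generated} {P′} generated-passage P′-passage ,
                              from (∈-∖ₑ generated P′) (x₀y₀∈generated , x₀y₀∉P′)))) ab∈P′

-- A minimal passage A is contained in, or disjoint from, every passage P:
-- otherwise A ∩ P would be a smaller non-empty passage.
minimal-split : ∀ {n} {E A P : EdgeSet n} → IsMinimalPassage E A → IsPassage E P →
                A ⊆ₑ P ⊎ Disjoint A P
minimal-split {E = E} {A} {P} (A-passage , A-minimal) P-passage with nonEmpty? (A ∩ₑ P)
... | no  A∩P-empty = inj₂ λ x y e → A∩P-empty (x , y , from (∈-∩ₑ A P) e)
... | yes A∩P-ne    = inj₁ λ x y e∈A → decidable-stable (x , y ∈? P) λ e∉P →
  A-minimal (A ∩ₑ P , ∩-passage {E = E} {A} {P} A-passage P-passage , A∩P-ne ,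
             (λ a b e → proj₁ (to (∈-∩ₑ A P) e)) ,
             λ A∩P≡A → e∉P (proj₂ (to (∈-∩ₑ A P) (subst (λ Q → x , y ∈ₑ Q) (sym A∩P≡A) e∈A))))

minimal-overlap : ∀ {n} {E A B : EdgeSet n} {x y} → IsMinimalPassage E A → IsMinimalPassage E B →
                  x , y ∈ₑ A → x , y ∈ₑ B → A ≡ B
minimal-overlap {E = E} {A} {B} {x} {y} A-min B-min e∈A e∈B
  with minimal-split {E = E} {A} {B} A-min (proj₁ B-min) | minimal-split {E = E} {B} {A} B-min (proj₁ A-min)
... | inj₁ A⊆B | inj₁ B⊆A = ⊆ₑ-antisym A⊆B B⊆A
... | inj₂ AB-disj | _        = ⊥-elim (AB-disj x y (e∈A , e∈B))
... | inj₁ _       | inj₂ BA-disj = ⊥-elim (BA-disj x y (e∈B , e∈A))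

rowSum : ∀ {n r} → Vec (Subset n) r → ℕ
rowSum R = V.sum (V.map ∣_∣ R)

rowSum-mono : ∀ {n r} (P Q : Vec (Subset n) r) → (∀ x → lookup P x ⊆ₛ lookup Q x) → rowSum P ≤ rowSum Q
rowSum-mono []      []      _   = z≤n
rowSum-mono (p ∷ P) (q ∷ Q) P⊆Q =
  ℕ.+-mono-≤ (Sub.p⊆q⇒∣p∣≤∣q∣ (P⊆Q zero)) (rowSum-mono P Q λ x → P⊆Q (suc x))

rowSum-strict : ∀ {n r} (P Q : Vec (Subset n) r) → (∀ x → lookup P x ⊆ₛ lookup Q x) →
                ∀ x → lookup P x ⊂ₛ lookup Q x → rowSum P < rowSum Q
rowSum-strict (p ∷ P) (q ∷ Q) P⊆Q zero    p⊂q =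
  ℕ.+-mono-<-≤ (Sub.p⊂q⇒∣p∣<∣q∣ p⊂q) (rowSum-mono P Q λ x → P⊆Q (suc x))
rowSum-strict (p ∷ P) (q ∷ Q) P⊆Q (suc x) P⊂Q =
  ℕ.+-mono-≤-< (Sub.p⊆q⇒∣p∣≤∣q∣ (P⊆Q zero)) (rowSum-strict P Q (λ x → P⊆Q (suc x)) x P⊂Q)

edgeCount-∖ : ∀ {n} (E P : EdgeSet n) → NonEmpty P → P ⊆ₑ E → edgeCount (E ∖ₑ P) < edgeCount E
edgeCount-∖ E P (x₀ , y₀ , e∈P) P⊆E =
  rowSum-strict (E ∖ₑ P) E (λ x {y} e → proj₁ (to (∈-∖ₑ E P) e))
    x₀ ((λ {y} e → proj₁ (to (∈-∖ₑ E P) e)) , y₀ , P⊆E x₀ y₀ e∈P , λ e → proj₂ (to (∈-∖ₑ E P) e) e∈P)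

disjoint-parts≤ : ∀ {n} (E : EdgeSet n) (Ps : List (EdgeSet n)) →
  All (λ P → NonEmpty P × P ⊆ₑ E) Ps → AllPairs Disjoint Ps → length Ps ≤ edgeCount E
disjoint-parts≤ E []       _                        _                 = z≤n
disjoint-parts≤ E (P ∷ Ps) ((P-ne , P⊆E) ∷ parts) (P-disj ∷ disj) =
  ℕ.≤-trans (s≤s (disjoint-parts≤ (E ∖ₑ P) Ps rest-parts disj)) (edgeCount-∖ E P P-ne P⊆E)
  where
  rest : ∀ {Q} → NonEmpty Q × Q ⊆ₑ E → Disjoint P Q → NonEmpty Q × Q ⊆ₑ E ∖ₑ P
  rest (Q-ne , Q⊆E) PQ-disj = Q-ne , λ x y e → from (∈-∖ₑ E P) (Q⊆E x y e , λ e′ → PQ-disj x y (e′ , e))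
  rest-parts : All (λ Q → NonEmpty Q × Q ⊆ₑ E ∖ₑ P) Ps
  rest-parts = All.tabulate λ {Q} Q∈ → rest {Q} (All.lookup parts Q∈) (All.lookup P-disj Q∈)

_≟ₛ_ : ∀ {m} (s t : Subset m) → Dec (s ≡ t)
_≟ₛ_ = VecP.≡-dec Bool._≟_

-- A block may be
-- listed repeatedly; IsPartitionList also forbids that.
record IsPartition {m} (q : List (Subset m)) : Set where
  field
    nonempty : All Nonempty q
    covers   : ∀ i → Any (i ∈ₛ_) q
    disjoint : ∀ {a b} i → a ∈ q → b ∈ q → i ∈ₛ a → i ∈ₛ b → a ≡ b
open IsPartition

IsPartitionList : ∀ {m} → List (Subset m) → Set
IsPartitionList q = Unique q × IsPartition q

-- A partition of Fin (suc m) arises from a partition p of Fin m by adding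
-- the new point zero to a block s of p, or to the empty set s = ∅ (forming a
-- new singleton block).
IsTarget : ∀ {m} → List (Subset m) → Subset m → Set
IsTarget p s = s ∈ p ⊎ s ≡ ∅

ExtendedBlock : ∀ {m} → List (Subset m) → Subset m → Subset (suc m) → Set
ExtendedBlock p s z = z ≡ true ∷ s ⊎ ∃[ t ] (t ∈ p × t ≢ s × z ≡ false ∷ t)

IsExtension : ∀ {m} → List (Subset m) → Subset m → List (Subset (suc m)) → Set
IsExtension p s h = ∀ {z} → z ∈ h ⇔ ExtendedBlock p s z

module _ {m : ℕ} where

  target-meets : ∀ {p : List (Subset m)} {s t i} → IsPartition p → IsTarget p s →
                 t ∈ p → i ∈ₛ s → i ∈ₛ t → s ≡ t
  target-meets P (inj₁ s∈p)  t∈p i∈s i∈t = disjoint P _ s∈p t∈p i∈s i∈t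
  target-meets P (inj₂ refl) _   i∈∅ _   = ⊥-elim (Sub.∉⊥ i∈∅)

  target-nonempty : ∀ {p : List (Subset m)} {s} → IsTarget p s → Nonempty s → s ∈ p
  target-nonempty (inj₁ s∈p)  _         = s∈p
  target-nonempty (inj₂ refl) (_ , i∈∅) = ⊥-elim (Sub.∉⊥ i∈∅)

  nonempty≢∅ : ∀ {t : Subset m} → Nonempty t → t ≢ ∅
  nonempty≢∅ (i , i∈t) refl = Sub.∉⊥ i∈t

  extension-cong : ∀ {p p′ : List (Subset m)} {s h h′} → p ∼[ set ] p′ →
                   IsExtension p s h → IsExtension p′ s h′ → h ∼[ set ] h′
  extension-cong {p} {p′} {s} p≈p′ h-ext h′-ext =
    ⇔.trans h-ext (⇔.trans (mk⇔ (move (to p≈p′)) (move (from p≈p′))) (⇔.sym h′-ext))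
    where
    move : ∀ {q q′ z} → (∀ {t} → t ∈ q → t ∈ q′) → ExtendedBlock q s z → ExtendedBlock q′ s z
    move f (inj₁ z≡)                 = inj₁ z≡
    move f (inj₂ (t , t∈ , t≢s , z≡)) = inj₂ (t , f t∈ , t≢s , z≡)

  -- The two ways of extending p: zero joins the block s (mark s t tags the
  -- block t with whether it is s), or zero forms the new block {zero}.
  mark : Subset m → Subset m → Subset (suc m)
  mark s t = does (t ≟ₛ s) ∷ t

  joinBlock : List (Subset m) → Subset m → List (Subset (suc m))
  joinBlock p s = map (mark s) p

  newBlock : List (Subset m) → List (Subset (suc m))
  newBlock p = (true ∷ ∅) ∷ map (false ∷_) p

  joinBlock-extension : ∀ {p s} → s ∈ p → IsExtension p s (joinBlock p s)
  joinBlock-extension {p} {s} s∈p = mk⇔ into onto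
    where
    marked : ∀ {t} → t ∈ p → ExtendedBlock p s (mark s t)
    marked {t} t∈p with t ≟ₛ s
    ... | yes refl = inj₁ refl
    ... | no  t≢s  = inj₂ (t , t∈p , t≢s , refl)
    mark-self : mark s s ≡ true ∷ s
    mark-self with s ≟ₛ s
    ... | yes _  = refl
    ... | no s≢s = ⊥-elim (s≢s refl)
    mark-other : ∀ {t} → t ≢ s → mark s t ≡ false ∷ t
    mark-other {t} t≢s with t ≟ₛ s
    ... | yes t≡s = ⊥-elim (t≢s t≡s)
    ... | no  _   = refl
    into : ∀ {z} → z ∈ joinBlock p s → ExtendedBlock p s z
    into z∈ with Mem.∈-map⁻ (mark s) z∈
    ... | t , t∈p , refl = marked t∈p
    onto : ∀ {z} → ExtendedBlock p s z → z ∈ joinBlock p s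
    onto (inj₁ refl) = subst (_∈ joinBlock p s) mark-self (Mem.∈-map⁺ (mark s) s∈p)
    onto (inj₂ (t , t∈p , t≢s , refl)) =
      subst (_∈ joinBlock p s) (mark-other t≢s) (Mem.∈-map⁺ (mark s) t∈p)

  newBlock-extension : ∀ {p} → All Nonempty p → IsExtension p ∅ (newBlock p)
  newBlock-extension {p} ne = mk⇔ into onto
    where
    into : ∀ {z} → z ∈ newBlock p → ExtendedBlock p ∅ z
    into (here z≡) = inj₁ z≡
    into (there z∈) with Mem.∈-map⁻ (false ∷_) z∈
    ... | t , t∈p , refl = inj₂ (t , t∈p , nonempty≢∅ (All.lookup ne t∈p) , refl)
    onto : ∀ {z} → ExtendedBlock p ∅ z → z ∈ newBlock p
    onto (inj₁ z≡)                  = here z≡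
    onto (inj₂ (t , t∈p , _ , refl)) = there (Mem.∈-map⁺ (false ∷_) t∈p)

  joinBlock-unique : ∀ {p s} → Unique p → Unique (joinBlock p s)
  joinBlock-unique = UniqueP.map⁺ VecP.∷-injectiveʳ

  newBlock-unique : ∀ {p} → Unique p → Unique (newBlock p)
  newBlock-unique p! = All.tabulate (λ z∈ → fresh (Mem.∈-map⁻ (false ∷_) z∈))
                     ∷ UniqueP.map⁺ VecP.∷-injectiveʳ p!
    where
    fresh : ∀ {p z} → ∃[ t ] (t ∈ p × z ≡ false ∷ t) → true ∷ ∅ ≢ z
    fresh (_ , _ , refl) ()

  extension-partition : ∀ {p s h} → IsPartition p → IsTarget p s → IsExtension p s h → IsPartition h
  extension-partition {p} {s} {h} P target h-ext = record
    { nonempty = All.tabulate (block-nonempty ∘ to h-ext)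
    ; covers   = cover
    ; disjoint = λ i a∈ b∈ → blocks-disjoint i (to h-ext a∈) (to h-ext b∈)
    }
    where
    block-nonempty : ∀ {z} → ExtendedBlock p s z → Nonempty z
    block-nonempty (inj₁ refl) = zero , V.here
    block-nonempty (inj₂ (t , t∈p , _ , refl)) with All.lookup (nonempty P) t∈p
    ... | i , i∈t = suc i , V.there i∈t
    cover : ∀ i → Any (i ∈ₛ_) h
    cover zero = lose (from h-ext (inj₁ refl)) V.here
    cover (suc i) with find (covers P i)
    ... | t , t∈p , i∈t with t ≟ₛ s
    ...   | yes refl = lose (from h-ext (inj₁ refl)) (V.there i∈t)
    ...   | no  t≢s  = lose (from h-ext (inj₂ (t , t∈p , t≢s , refl))) (V.there i∈t)
    blocks-disjoint : ∀ {a b} i → ExtendedBlock p s a → ExtendedBlock p s b →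
                      i ∈ₛ a → i ∈ₛ b → a ≡ b
    blocks-disjoint _ (inj₁ refl) (inj₁ refl) _ _ = refl
    blocks-disjoint (suc i) (inj₁ refl) (inj₂ (t , t∈p , t≢s , refl)) (V.there i∈s) (V.there i∈t) =
      ⊥-elim (t≢s (sym (target-meets P target t∈p i∈s i∈t)))
    blocks-disjoint (suc i) (inj₂ (t , t∈p , t≢s , refl)) (inj₁ refl) (V.there i∈t) (V.there i∈s) =
      ⊥-elim (t≢s (sym (target-meets P target t∈p i∈s i∈t)))
    blocks-disjoint (suc i) (inj₂ (t , t∈p , _ , refl)) (inj₂ (t′ , t′∈p , _ , refl))
                    (V.there i∈t) (V.there i∈t′) =
      cong (false ∷_) (disjoint P i t∈p t′∈p i∈t i∈t′)

  restrict : List (Subset (suc m)) → List (Subset m)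
  restrict q = filter Sub.nonempty? (map V.tail q)

  ∈-restrict : ∀ {q t} → t ∈ restrict q ⇔ (Nonempty t × ∃[ b ] (b ∷ t ∈ q))
  ∈-restrict {q} {t} = mk⇔ into onto
    where
    onto : Nonempty t × ∃[ b ] (b ∷ t ∈ q) → t ∈ restrict q
    onto (ne , b , bt∈q) = Mem.∈-filter⁺ Sub.nonempty? (Mem.∈-map⁺ V.tail bt∈q) ne
    into : t ∈ restrict q → Nonempty t × ∃[ b ] (b ∷ t ∈ q)
    into t∈ with Mem.∈-filter⁻ Sub.nonempty? {xs = map V.tail q} t∈
    ... | t∈tails , ne with Mem.∈-map⁻ V.tail t∈tails
    ... | (b ∷ _) , bt∈q , refl = ne , b , bt∈q

  restrict-cong : ∀ {q q′} → q ∼[ set ] q′ → restrict q ∼[ set ] restrict q′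
  restrict-cong q≈q′ = mk⇔ (move (to q≈q′)) (move (from q≈q′))
    where
    move : ∀ {q q′ t} → (∀ {z} → z ∈ q → z ∈ q′) → t ∈ restrict q → t ∈ restrict q′
    move f t∈ = let (ne , b , bt∈) = to ∈-restrict t∈ in from ∈-restrict (ne , b , f bt∈)

  restrict-extension : ∀ {p s h} → All Nonempty p → IsTarget p s → IsExtension p s h →
                       restrict h ∼[ set ] p
  restrict-extension {p} {s} {h} ne target h-ext = mk⇔ into onto
    where
    into : ∀ {t} → t ∈ restrict h → t ∈ p
    into t∈ with to ∈-restrict t∈
    ... | t-ne , b , bt∈h with to h-ext bt∈h
    ... | inj₁ bt≡ = subst (_∈ p) (sym (VecP.∷-injectiveʳ bt≡))
                       (target-nonempty target (subst Nonempty (VecP.∷-injectiveʳ bt≡) t-ne))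
    ... | inj₂ (t′ , t′∈p , _ , bt≡) = subst (_∈ p) (sym (VecP.∷-injectiveʳ bt≡)) t′∈p
    onto : ∀ {t} → t ∈ p → t ∈ restrict h
    onto {t} t∈p with t ≟ₛ s
    ... | yes refl = from ∈-restrict (All.lookup ne t∈p , true , from h-ext (inj₁ refl))
    ... | no  t≢s  =
      from ∈-restrict (All.lookup ne t∈p , false , from h-ext (inj₂ (t , t∈p , t≢s , refl)))

  extension-injective : ∀ {p p′ s s′ h h′} → All Nonempty p → All Nonempty p′ →
    IsTarget p s → IsTarget p′ s′ → IsExtension p s h → IsExtension p′ s′ h′ →
    h ∼[ set ] h′ → p ∼[ set ] p′ × s ≡ s′
  extension-injective ne ne′ target target′ h-ext h′-ext h≈h′ =
    ⇔.trans (⇔.sym (restrict-extension ne target h-ext))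
            (⇔.trans (restrict-cong h≈h′) (restrict-extension ne′ target′ h′-ext)) ,
    zero-block (to h′-ext (to h≈h′ (from h-ext (inj₁ refl))))
    where
    zero-block : ∀ {p s s′} → ExtendedBlock p s′ (true ∷ s) → s ≡ s′
    zero-block (inj₁ eq)              = VecP.∷-injectiveʳ eq
    zero-block (inj₂ (_ , _ , _ , ()))

  restrict-partition : ∀ {q} → IsPartition q → IsPartition (restrict q)
  restrict-partition {q} Q = record
    { nonempty = All.tabulate (proj₁ ∘ to (∈-restrict {q}))
    ; covers   = cover
    ; disjoint = λ i a∈ b∈ → shared i (to (∈-restrict {q}) a∈) (to (∈-restrict {q}) b∈)
    }
    where
    cover : ∀ i → Any (i ∈ₛ_) (restrict q)
    cover i with find (covers Q (suc i))
    ... | (b ∷ t) , bt∈q , V.there i∈t = lose (from ∈-restrict ((i , i∈t) , b , bt∈q)) i∈t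
    shared : ∀ {a b} i → Nonempty a × ∃[ c ] (c ∷ a ∈ q) → Nonempty b × ∃[ d ] (d ∷ b ∈ q) →
             i ∈ₛ a → i ∈ₛ b → a ≡ b
    shared i (_ , c , ca∈q) (_ , d , db∈q) i∈a i∈b =
      VecP.∷-injectiveʳ (disjoint Q (suc i) ca∈q db∈q (V.there i∈a) (V.there i∈b))

  restriction-target : ∀ {q s₀} → true ∷ s₀ ∈ q → IsTarget (restrict q) s₀
  restriction-target {q} {s₀} s₀∈q with Sub.nonempty? s₀
  ... | yes ne = inj₁ (from ∈-restrict (ne , true , s₀∈q))
  ... | no  ¬ne = inj₂ (Sub.Empty-unique ¬ne)

  restriction-extension : ∀ {q s₀} → IsPartition q → true ∷ s₀ ∈ q → IsExtension (restrict q) s₀ q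
  restriction-extension {q} {s₀} Q s₀∈q = mk⇔ into onto
    where
    into : ∀ {z} → z ∈ q → ExtendedBlock (restrict q) s₀ z
    into {true ∷ t} z∈q = inj₁ (disjoint Q zero z∈q s₀∈q V.here V.here)
    into {false ∷ t} z∈q with All.lookup (nonempty Q) z∈q
    ... | suc i , V.there i∈t = inj₂ (t , from ∈-restrict ((i , i∈t) , false , z∈q) , t≢s₀ , refl)
      where
      t≢s₀ : t ≢ s₀
      t≢s₀ refl with disjoint Q (suc i) z∈q s₀∈q (V.there i∈t) (V.there i∈t)
      ... | ()
    onto : ∀ {z} → ExtendedBlock (restrict q) s₀ z → z ∈ q
    onto (inj₁ refl) = s₀∈q
    onto (inj₂ (t , t∈ , t≢s₀ , refl)) with to ∈-restrict t∈
    ... | _ , false , ft∈q = ft∈q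
    ... | _ , true  , tt∈q = ⊥-elim (t≢s₀ (VecP.∷-injectiveʳ (disjoint Q zero tt∈q s₀∈q V.here V.here)))

  joinBlock-injective : ∀ {p p′ s s′} → IsPartition p → IsPartition p′ → s ∈ p → s′ ∈ p′ →
    joinBlock p s ∼[ set ] joinBlock p′ s′ → p ∼[ set ] p′ × s ≡ s′
  joinBlock-injective P P′ s∈p s′∈p′ =
    extension-injective (nonempty P) (nonempty P′) (inj₁ s∈p) (inj₁ s′∈p′)
                        (joinBlock-extension s∈p) (joinBlock-extension s′∈p′)

  newBlock-injective : ∀ {p p′} → IsPartition p → IsPartition p′ →
    newBlock p ∼[ set ] newBlock p′ → p ∼[ set ] p′
  newBlock-injective P P′ eq =
    proj₁ (extension-injective (nonempty P) (nonempty P′) (inj₂ refl) (inj₂ refl)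
                               (newBlock-extension (nonempty P)) (newBlock-extension (nonempty P′)) eq)

  joinBlock≉newBlock : ∀ {p p′ s} → IsPartition p → IsPartition p′ → s ∈ p →
    ¬ joinBlock p s ∼[ set ] newBlock p′
  joinBlock≉newBlock P P′ s∈p eq =
    nonempty≢∅ (All.lookup (nonempty P) s∈p)
      (proj₂ (extension-injective (nonempty P) (nonempty P′) (inj₁ s∈p) (inj₂ refl)
                                  (joinBlock-extension s∈p) (newBlock-extension (nonempty P′)) eq))

-- partitions m j lists the partitions of Fin m into j blocks, following the
-- recurrence S(m+1, j+1) = (j+1) S(m, j+1) + S(m, j): zero either joins one
-- of the j+1 blocks of a partition of the other points, or forms a new block.
joinings : ∀ {m} → List (Subset m) → List (List (Subset (suc m)))
joinings p = map (joinBlock p) p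

partitions : (m j : ℕ) → List (List (Subset m))
partitions zero    zero    = [ [] ]
partitions zero    (suc j) = []
partitions (suc m) zero    = []
partitions (suc m) (suc j) =
  concatMap joinings (partitions m (suc j)) ++ map newBlock (partitions m j)

partitions-blocks : ∀ m j → All (λ p → length p ≡ j) (partitions m j)
partitions-blocks zero    zero    = refl ∷ []
partitions-blocks zero    (suc j) = []
partitions-blocks (suc m) zero    = []
partitions-blocks (suc m) (suc j) =
  AllP.++⁺ (AllP.concat⁺ (AllP.map⁺ (All.map joined (partitions-blocks m (suc j)))))
           (AllP.map⁺ (All.map (λ {p} → added {p}) (partitions-blocks m j)))
  where
  joined : ∀ {p} → length p ≡ suc j → All (λ h → length h ≡ suc j) (joinings p)
  joined {p} len = AllP.map⁺ (All.tabulate λ _ → trans (ListP.length-map _ p) len)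
  added : ∀ {p} → length p ≡ j → length (newBlock p) ≡ suc j
  added {p} len = cong suc (trans (ListP.length-map _ p) len)

partitions-valid : ∀ m j → All IsPartitionList (partitions m j)
partitions-valid zero    zero    =
  ([] , record { nonempty = [] ; covers = λ () ; disjoint = λ _ () }) ∷ []
partitions-valid zero    (suc j) = []
partitions-valid (suc m) zero    = []
partitions-valid (suc m) (suc j) =
  AllP.++⁺ (AllP.concat⁺ (AllP.map⁺ (All.map joined (partitions-valid m (suc j)))))
           (AllP.map⁺ (All.map added (partitions-valid m j)))
  where
  joined : ∀ {p} → IsPartitionList p → All IsPartitionList (joinings p)
  joined (p! , P) = AllP.map⁺ (All.tabulate λ s∈p →
    joinBlock-unique p! , extension-partition P (inj₁ s∈p) (joinBlock-extension s∈p))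
  added : ∀ {p} → IsPartitionList p → IsPartitionList (newBlock p)
  added (p! , P) = newBlock-unique p! , extension-partition P (inj₂ refl) (newBlock-extension (nonempty P))

-- No two listed partitions have the same blocks: by extension-injective,
-- different joinings of one partition differ in the block of zero,
-- extensions of different partitions differ in their restrictions, and a
-- joining never has the singleton block {zero}.
partitions-distinct : ∀ m j → AllPairs (λ h h′ → ¬ h ∼[ set ] h′) (partitions m j)
partitions-distinct zero    zero    = [] ∷ []
partitions-distinct zero    (suc j) = []
partitions-distinct (suc m) zero    = []
partitions-distinct (suc m) (suc j) =
  AllPairsP.++⁺
    (AllPairsP.concat⁺
      (AllP.map⁺ (All.tabulate within))
      (AllPairsP.map⁺ (AllPairs-mapWith across (All.tabulate id) (partitions-distinct m (suc j)))))
    (AllPairsP.map⁺ (AllPairs-mapWith added (All.tabulate id) (partitions-distinct m j)))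
    (AllP.concat⁺ (AllP.map⁺ (All.tabulate λ p∈ → AllP.map⁺ (All.tabulate λ s∈p →
       AllP.map⁺ (All.tabulate λ p′∈ → joinBlock≉newBlock (valid p∈) (valid′ p′∈) s∈p)))))
  where
  valid : ∀ {p} → p ∈ partitions m (suc j) → IsPartition p
  valid p∈ = proj₂ (All.lookup (partitions-valid m (suc j)) p∈)
  valid′ : ∀ {p} → p ∈ partitions m j → IsPartition p
  valid′ p∈ = proj₂ (All.lookup (partitions-valid m j) p∈)
  within : ∀ {p} → p ∈ partitions m (suc j) → AllPairs (λ h h′ → ¬ h ∼[ set ] h′) (joinings p)
  within p∈ = AllPairsP.map⁺ (AllPairs-mapWith
    (λ s∈p s′∈p s≢s′ eq → s≢s′ (proj₂ (joinBlock-injective (valid p∈) (valid p∈) s∈p s′∈p eq)))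
    (All.tabulate id) (proj₁ (All.lookup (partitions-valid m (suc j)) p∈)))
  across : ∀ {p p′} → p ∈ partitions m (suc j) → p′ ∈ partitions m (suc j) → ¬ p ∼[ set ] p′ →
           All (λ h → All (λ h′ → ¬ h ∼[ set ] h′) (joinings p′)) (joinings p)
  across p∈ p′∈ p≉p′ = AllP.map⁺ (All.tabulate λ s∈p → AllP.map⁺ (All.tabulate λ s′∈p′ eq →
    p≉p′ (proj₁ (joinBlock-injective (valid p∈) (valid p′∈) s∈p s′∈p′ eq))))
  added : ∀ {p p′} → p ∈ partitions m j → p′ ∈ partitions m j → ¬ p ∼[ set ] p′ →
          ¬ newBlock p ∼[ set ] newBlock p′
  added p∈ p′∈ p≉p′ eq = p≉p′ (newBlock-injective (valid′ p∈) (valid′ p′∈) eq)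

extension-listed : ∀ {m j q s₀ g} → IsPartition q → true ∷ s₀ ∈ q → g ∈ partitions m j →
  restrict q ∼[ set ] g → ∃[ j′ ] Any (q ∼[ set ]_) (partitions (suc m) j′)
extension-listed {m} {j} {q} {s₀} {g} Q s₀∈q g∈ restricted≈g = by-target j g∈ (restriction-target s₀∈q)
  where
  q≈ : ∀ {h} → IsExtension g s₀ h → q ∼[ set ] h
  q≈ = extension-cong restricted≈g (restriction-extension Q s₀∈q)
  no-blocks : ∀ {g′ : List (Subset m)} → length g′ ≡ 0 → s₀ ∉ g′
  no-blocks {[]} _ ()
  by-target : ∀ k → g ∈ partitions m k → IsTarget (restrict q) s₀ →
              ∃[ j′ ] Any (q ∼[ set ]_) (partitions (suc m) j′)
  by-target k g∈ₖ (inj₂ refl) = suc k ,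
    lose (Mem.∈-++⁺ʳ _ (Mem.∈-map⁺ newBlock g∈ₖ))
         (q≈ (newBlock-extension (nonempty (proj₂ (All.lookup (partitions-valid m k) g∈ₖ)))))
  by-target zero g∈ₖ (inj₁ s₀∈) =
    ⊥-elim (no-blocks (All.lookup (partitions-blocks m zero) g∈ₖ) (to restricted≈g s₀∈))
  by-target (suc k) g∈ₖ (inj₁ s₀∈) = suc k ,
    lose (Mem.∈-++⁺ˡ (Mem.∈-concatMap⁺ joinings (lose g∈ₖ (Mem.∈-map⁺ (joinBlock g) (to restricted≈g s₀∈)))))
         (q≈ (joinBlock-extension (to restricted≈g s₀∈)))

partitions-complete : ∀ m q → IsPartition q → ∃[ j ] Any (q ∼[ set ]_) (partitions m j)
partitions-complete zero    []      _ = zero , here (mk⇔ id id)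
partitions-complete zero    (_ ∷ _) Q with All.head (nonempty Q)
... | () , _
partitions-complete (suc m) q Q with find (covers Q zero)
... | (true ∷ s₀) , s₀∈q , V.here with partitions-complete m (restrict q) (restrict-partition Q)
...   | j , found with find found
...     | g , g∈ , restricted≈g = extension-listed Q s₀∈q g∈ restricted≈g

length-concatMap : ∀ {A B : Set} {f : A → List B} {c} {xs} →
                   All (λ x → length (f x) ≡ c) xs → length (concatMap f xs) ≡ c * length xs
length-concatMap {c = c} [] = sym (ℕ.*-zeroʳ c)
length-concatMap {f = f} {c} {x ∷ xs} (fx≡c ∷ rest) = begin
  length (f x ++ concatMap f xs)         ≡⟨ ListP.length-++ (f x) ⟩
  length (f x) + length (concatMap f xs) ≡⟨ cong₂ _+_ fx≡c (length-concatMap rest) ⟩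
  c + c * length xs                      ≡⟨ ℕ.*-suc c (length xs) ⟨
  c * suc (length xs)                    ∎
  where open ≡-Reasoning

length-partitions : ∀ m j → length (partitions m j) ≡ stirling2 m j
length-partitions zero    zero    = refl
length-partitions zero    (suc j) = refl
length-partitions (suc m) zero    = refl
length-partitions (suc m) (suc j) = begin
  length (concatMap joinings Ps ++ map newBlock Qs)
    ≡⟨ ListP.length-++ (concatMap joinings Ps) ⟩
  length (concatMap joinings Ps) + length (map newBlock Qs)
    ≡⟨ cong₂ _+_ (length-concatMap joinings-length) (ListP.length-map newBlock Qs) ⟩
  suc j * length Ps + length Qs
    ≡⟨ cong₂ _+_ (cong (suc j *_) (length-partitions m (suc j))) (length-partitions m j) ⟩
  suc j * stirling2 m (suc j) + stirling2 m j ∎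
  where
  open ≡-Reasoning
  Ps = partitions m (suc j)
  Qs = partitions m j
  joinings-length : All (λ p → length (joinings p) ≡ suc j) Ps
  joinings-length = All.map (λ {p} len → trans (ListP.length-map _ p) len) (partitions-blocks m (suc j))

partitions-empty : ∀ m j → m < j → partitions m j ≡ []
partitions-empty zero    (suc j) _         = refl
partitions-empty (suc m) (suc j) (s≤s m<j)
  rewrite partitions-empty m (suc j) (ℕ.m<n⇒m<1+n m<j) | partitions-empty m j m<j = refl

partitionsBelow : (m t : ℕ) → List (List (Subset m))
partitionsBelow m zero    = []
partitionsBelow m (suc t) = partitionsBelow m t ++ partitions m t

length-partitionsBelow : ∀ m t → length (partitionsBelow m t) ≡ sumBelow t (stirling2 m)
length-partitionsBelow m zero    = refl
length-partitionsBelow m (suc t) =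
  trans (ListP.length-++ (partitionsBelow m t))
        (cong₂ _+_ (length-partitionsBelow m t) (length-partitions m t))

partitionsBelow-blocks : ∀ m t → All (λ p → length p < t) (partitionsBelow m t)
partitionsBelow-blocks m zero    = []
partitionsBelow-blocks m (suc t) =
  AllP.++⁺ (All.map ℕ.m<n⇒m<1+n (partitionsBelow-blocks m t))
           (All.map (λ len → ℕ.≤-reflexive (cong suc len)) (partitions-blocks m t))

partitionsBelow-valid : ∀ m t → All IsPartitionList (partitionsBelow m t)
partitionsBelow-valid m zero    = []
partitionsBelow-valid m (suc t) = AllP.++⁺ (partitionsBelow-valid m t) (partitions-valid m t)

-- Distinct members are not permutations of each other: within a level they
-- have different blocks, across levels different numbers of blocks.
partitionsBelow-distinct : ∀ m t → AllPairs (λ p p′ → ¬ (p ↭ p′)) (partitionsBelow m t)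
partitionsBelow-distinct m zero    = []
partitionsBelow-distinct m (suc t) =
  AllPairsP.++⁺ (partitionsBelow-distinct m t)
    (AllPairs.map (λ p≉p′ p↭p′ → p≉p′ (↭⇒set p↭p′)) (partitions-distinct m t))
    (All.tabulate λ p∈ → All.tabulate λ p′∈ p↭p′ →
       ℕ.<-irrefl (trans (Perm.↭-length p↭p′) (All.lookup (partitions-blocks m t) p′∈))
                  (All.lookup (partitionsBelow-blocks m t) p∈))

partitionsBelow-∈ : ∀ m {j t g} → j < t → g ∈ partitions m j → g ∈ partitionsBelow m t
partitionsBelow-∈ m {j} {suc t} j<1+t g∈ with ℕ.m≤n⇒m<n∨m≡n (ℕ.≤-pred j<1+t)
... | inj₁ j<t  = Mem.∈-++⁺ˡ (partitionsBelow-∈ m j<t g∈)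
... | inj₂ refl = Mem.∈-++⁺ʳ (partitionsBelow m j) g∈

partition-listed : ∀ {m} {q : List (Subset m)} → IsPartitionList q →
                   ∃[ g ] (g ∈ partitionsBelow m (suc m) × q ↭ g)
partition-listed {m} {q} (q! , Q) with partitions-complete m q Q
... | j , found with find found
... | g , g∈ , q≈g with m ℕ.<? j
... | yes m<j = ⊥-elim (subst (λ gs → g ∉ gs) (sym (partitions-empty m j m<j)) (λ ()) g∈)
... | no  m≮j = g , partitionsBelow-∈ m (s≤s (ℕ.≮⇒≥ m≮j)) g∈ ,
                set⇒↭ q! (proj₁ (All.lookup (partitions-valid m j) g∈)) q≈g

bell-partitions : ∀ m → CountUpToPerm (IsPartitionList {m}) (bell m)
bell-partitions m =
  partitionsBelow m (suc m) , partitionsBelow-distinct m (suc m) , partitionsBelow-valid m (suc m) ,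
  (λ q q-valid → let (g , g∈ , q↭g) = partition-listed q-valid in lose g∈ q↭g) ,
  length-partitionsBelow m (suc m)

partition-blocks≤ : ∀ {m} {q : List (Subset m)} → IsPartitionList q → length q ≤ m
partition-blocks≤ {m} q-valid with partition-listed q-valid
... | g , g∈ , q↭g =
  ℕ.≤-pred (subst (_< suc m) (sym (Perm.↭-length q↭g))
                  (All.lookup (partitionsBelow-blocks m (suc m)) g∈))

-- Throughout, L lists the non-empty minimal passages of E (the "atoms"),
-- each exactly once; atom i is its i-th entry.
module Atoms {n} (E : EdgeSet n) (L : List (EdgeSet n)) (L! : Unique L)
             (L-atoms : ∀ P → (P ∈ L) ⇔ (NonEmpty P × IsMinimalPassage E P)) where

  k : ℕ
  k = length L

  atom : Fin k → EdgeSet n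
  atom = List.lookup L

  atom-nonempty : ∀ i → NonEmpty (atom i)
  atom-nonempty i = proj₁ (to (L-atoms (atom i)) (Mem.∈-lookup i))

  atom-minimal : ∀ i → IsMinimalPassage E (atom i)
  atom-minimal i = proj₂ (to (L-atoms (atom i)) (Mem.∈-lookup i))

  atom-passage : ∀ i → IsPassage E (atom i)
  atom-passage i = proj₁ (atom-minimal i)

  atom⊆E : ∀ i → atom i ⊆ₑ E
  atom⊆E i = proj₁ (atom-passage i)

  -- Every edge of E lies in an atom: the passage it generates.
  atom-of : ∀ {x y} → x , y ∈ₑ E → ∃[ i ] (x , y ∈ₑ atom i)
  atom-of {x} {y} xy∈E =
    Any.index gen∈L , subst (λ Q → x , y ∈ₑ Q) (AnyP.lookup-index gen∈L) (x₀y₀∈generated xy∈E)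
    where
    open Generated E x y
    gen∈L : generated ∈ L
    gen∈L = from (L-atoms generated) ((x , y , x₀y₀∈generated xy∈E) , generated-minimal xy∈E)

  atom-⊆ : ∀ i {P x y} → IsPassage E P → x , y ∈ₑ atom i → x , y ∈ₑ P → atom i ⊆ₑ P
  atom-⊆ i {P} {x} {y} P-passage e∈A e∈P
    with minimal-split {E = E} {atom i} {P} (atom-minimal i) P-passage
  ... | inj₁ A⊆P    = A⊆P
  ... | inj₂ AP-disj = ⊥-elim (AP-disj x y (e∈A , e∈P))

  atoms-disjoint : ∀ {i j x y} → x , y ∈ₑ atom i → x , y ∈ₑ atom j → i ≡ j
  atoms-disjoint {i} {j} e∈i e∈j =
    lookup-injective L!
      (minimal-overlap {E = E} {atom i} {atom j} (atom-minimal i) (atom-minimal j) e∈i e∈j)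

  union : Subset k → EdgeSet n
  union s = edgesOf λ x y → Fin.any? λ i → (i Sub.∈? s) ×-dec (x , y ∈? atom i)

  ∈-union : ∀ s {x y} → x , y ∈ₑ union s ⇔ (∃[ i ] (i ∈ₛ s × x , y ∈ₑ atom i))
  ∈-union s {x} {y} = ∈-edgesOf _ x y

  atomsIn : EdgeSet n → Subset k
  atomsIn P = subsetOf λ i → atom i ⊆ₑ? P

  ∈-atomsIn : ∀ P {i} → i ∈ₛ atomsIn P ⇔ atom i ⊆ₑ P
  ∈-atomsIn P {i} = ∈-subsetOf (λ i → atom i ⊆ₑ? P) i

  union-passage : ∀ s → IsPassage E (union s)
  union-passage s =
    (λ x y e → let (i , _ , e∈i) = to (∈-union s) e in atom⊆E i x y e∈i) ,
    λ x y x′ y′ e e₁ e₂ →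
      let (i , i∈s , e∈i) = to (∈-union s) e
          (c₁ , c₂) = proj₂ (atom-passage i) x y x′ y′ e∈i e₁ e₂
      in from (∈-union s) (i , i∈s , c₁) , from (∈-union s) (i , i∈s , c₂)

  union-nonempty : ∀ {s} → Nonempty s → NonEmpty (union s)
  union-nonempty {s} (i , i∈s) with atom-nonempty i
  ... | x , y , e∈i = x , y , from (∈-union s) (i , i∈s , e∈i)

  atomsIn-union : ∀ s → atomsIn (union s) ≡ s
  atomsIn-union s = Sub.⊆-antisym inside outside
    where
    outside : ∀ {i} → i ∈ₛ s → i ∈ₛ atomsIn (union s)
    outside i∈s = from (∈-atomsIn (union s)) λ x y e → from (∈-union s) (_ , i∈s , e)
    inside : ∀ {i} → i ∈ₛ atomsIn (union s) → i ∈ₛ s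
    inside {i} i∈ with atom-nonempty i
    ... | x , y , e∈i with to (∈-union s) (to (∈-atomsIn (union s)) i∈ x y e∈i)
    ... | j , j∈s , e∈j = subst (_∈ₛ s) (atoms-disjoint e∈j e∈i) j∈s

  union-atomsIn : ∀ {P} → IsPassage E P → union (atomsIn P) ≡ P
  union-atomsIn {P} P-passage = ⊆ₑ-antisym
    (λ x y e → let (i , i∈ , e∈i) = to (∈-union (atomsIn P)) e in to (∈-atomsIn P) i∈ x y e∈i)
    λ x y e∈P →
      let (i , e∈i) = atom-of (proj₁ P-passage x y e∈P)
          i∈ = from (∈-atomsIn P) (atom-⊆ i {P} P-passage e∈i e∈P)
      in from (∈-union (atomsIn P)) (i , i∈ , e∈i)

  union-injective : ∀ {s t} → union s ≡ union t → s ≡ t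
  union-injective {s} {t} eq = trans (sym (atomsIn-union s)) (trans (cong atomsIn eq) (atomsIn-union t))

  atomsIn-injective : ∀ {P Q} → IsPassage E P → IsPassage E Q → atomsIn P ≡ atomsIn Q → P ≡ Q
  atomsIn-injective {P} {Q} P-passage Q-passage eq =
    trans (sym (union-atomsIn P-passage)) (trans (cong union eq) (union-atomsIn Q-passage))

  passages-count : HasCard (IsPassage E) (2 ^ k)
  passages-count =
    map union (allSubsets k) ,
    UniqueP.map⁺ union-injective (allSubsets-unique k) ,
    (λ P → mk⇔ listed-passage (all-listed P)) ,
    trans (ListP.length-map union (allSubsets k)) (length-allSubsets k)
    where
    listed-passage : ∀ {P} → P ∈ map union (allSubsets k) → IsPassage E P
    listed-passage P∈ =
      let (s , _ , P≡) = Mem.∈-map⁻ union P∈ in subst (IsPassage E) (sym P≡) (union-passage s)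
    all-listed : ∀ P → IsPassage E P → P ∈ map union (allSubsets k)
    all-listed P P-passage = subst (_∈ map union (allSubsets k)) (union-atomsIn P-passage)
                                   (Mem.∈-map⁺ union (∈-allSubsets (atomsIn P)))

  union-partitioning : ∀ {q} → IsPartitionList q → IsPassagePartitioning E (map union q)
  union-partitioning {q} (q! , Q) =
    UniqueP.map⁺ union-injective q! ,
    AllP.map⁺ (All.map (λ {s} s-ne → union-passage s , union-nonempty s-ne) (nonempty Q)) ,
    (λ x y → mk⇔ covered inside-E) ,
    AllPairsP.map⁺ (AllPairs-mapWith disjoint-unions (All.tabulate id) q!)
    where
    covered : ∀ {x y} → x , y ∈ₑ E → Any (λ P → x , y ∈ₑ P) (map union q)
    covered e∈E with atom-of e∈E
    ... | i , e∈i with find (covers Q i)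
    ... | s , s∈q , i∈s = lose (Mem.∈-map⁺ union s∈q) (from (∈-union s) (i , i∈s , e∈i))
    inside-E : ∀ {x y} → Any (λ P → x , y ∈ₑ P) (map union q) → x , y ∈ₑ E
    inside-E {x} {y} e∈ with find (AnyP.map⁻ e∈)
    ... | s , _ , e∈s = let (i , _ , e∈i) = to (∈-union s) e∈s in atom⊆E i x y e∈i
    disjoint-unions : ∀ {a b} → a ∈ q → b ∈ q → a ≢ b → Disjoint (union a) (union b)
    disjoint-unions {a} {b} a∈q b∈q a≢b x y (e∈a , e∈b) =
      let (i , i∈a , e∈i) = to (∈-union a) e∈a
          (j , j∈b , e∈j) = to (∈-union b) e∈b
      in a≢b (disjoint Q i a∈q b∈q i∈a (subst (_∈ₛ b) (atoms-disjoint e∈j e∈i) j∈b))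

  atomsIn-partition : ∀ {Ps} → IsPassagePartitioning E Ps → IsPartitionList (map atomsIn Ps)
  atomsIn-partition {Ps} (Ps! , Ps-valid , Ps-cover , Ps-disjoint) =
    AllPairsP.map⁺ (AllPairs-mapWith (λ P-passage Q-passage P≢Q → P≢Q ∘ atomsIn-injective P-passage Q-passage)
                                      (All.map proj₁ Ps-valid) Ps!) ,
    record
      { nonempty = AllP.map⁺ (All.map (λ {P} → atoms-nonempty {P}) Ps-valid)
      ; covers   = cover
      ; disjoint = λ i s∈ t∈ → shared i (Mem.∈-map⁻ atomsIn s∈) (Mem.∈-map⁻ atomsIn t∈)
      }
    where
    passage : ∀ {P} → P ∈ Ps → IsPassage E P
    passage P∈ = proj₁ (All.lookup Ps-valid P∈)
    atoms-nonempty : ∀ {P} → IsPassage E P × NonEmpty P → Nonempty (atomsIn P)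
    atoms-nonempty {P} (P-passage , x , y , e∈P) =
      let (i , e∈i) = atom-of (proj₁ P-passage x y e∈P)
      in i , from (∈-atomsIn P) (atom-⊆ i {P} P-passage e∈i e∈P)
    cover : ∀ i → Any (i ∈ₛ_) (map atomsIn Ps)
    cover i with atom-nonempty i
    ... | x , y , e∈i with find (to (Ps-cover x y) (atom⊆E i x y e∈i))
    ... | P , P∈ , e∈P =
      lose (Mem.∈-map⁺ atomsIn P∈) (from (∈-atomsIn P) (atom-⊆ i {P} (passage P∈) e∈i e∈P))
    shared : ∀ {s t} i → ∃[ P ] (P ∈ Ps × s ≡ atomsIn P) → ∃[ Q ] (Q ∈ Ps × t ≡ atomsIn Q) →
             i ∈ₛ s → i ∈ₛ t → s ≡ t
    shared i (P , P∈ , refl) (Q , Q∈ , refl) i∈P i∈Q with atom-nonempty i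
    ... | x , y , e∈i with to (∈-atomsIn P) i∈P x y e∈i | to (∈-atomsIn Q) i∈Q x y e∈i
    ...   | e∈P | e∈Q with Mem.∈-AllPairs₂ Ps-disjoint P∈ Q∈
    ...     | inj₁ refl           = refl
    ...     | inj₂ (inj₁ PQ-disj) = ⊥-elim (PQ-disj x y (e∈P , e∈Q))
    ...     | inj₂ (inj₂ QP-disj) = ⊥-elim (QP-disj x y (e∈Q , e∈P))

  union-atomsIn-list : ∀ {Ps} → All (IsPassage E) Ps → map union (map atomsIn Ps) ≡ Ps
  union-atomsIn-list []                    = refl
  union-atomsIn-list (P-passage ∷ passages) =
    cong₂ _∷_ (union-atomsIn P-passage) (union-atomsIn-list passages)

  partitionings-count : HasCardUpToPerm (IsPassagePartitioning E) (bell k)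
  partitionings-count =
    count-transfer union atomsIn atomsIn-union union-partitioning
      (λ Ps-valid → atomsIn-partition Ps-valid ,
                    union-atomsIn-list (All.map proj₁ (proj₁ (proj₂ Ps-valid))))
      (bell-partitions k)

  partitioning-size : ∀ Ps → IsPassagePartitioning E Ps → length Ps ≤ k
  partitioning-size Ps Ps-valid =
    subst (_≤ k) (ListP.length-map atomsIn Ps) (partition-blocks≤ (atomsIn-partition Ps-valid))

  atoms≤edges : k ≤ edgeCount E
  atoms≤edges = disjoint-parts≤ E L
    (All.tabulate λ {P} P∈ → let (P-ne , P-min) = to (L-atoms P) P∈ in P-ne , proj₁ (proj₁ P-min))
    (AllPairs-mapWith distinct-disjoint (All.tabulate id) L!)
    where
    distinct-disjoint : ∀ {P Q} → P ∈ L → Q ∈ L → P ≢ Q → Disjoint P Q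
    distinct-disjoint {P} {Q} P∈ Q∈ P≢Q x y (e∈P , e∈Q) =
      P≢Q (minimal-overlap {E = E} {P} {Q} (proj₂ (to (L-atoms P) P∈)) (proj₂ (to (L-atoms Q) Q∈)) e∈P e∈Q)

mainTheorem8 : ∀ {n} (E : EdgeSet n) (k : ℕ)
    → HasCard (λ P → NonEmpty P × IsMinimalPassage E P) k
    → HasCard (IsPassage E) (2 ^ k)
      × HasCardUpToPerm (IsPassagePartitioning E) (bell k)
      × (∀ Ps → IsPassagePartitioning E Ps → length Ps ≤ k × k ≤ edgeCount E)
mainTheorem8 E .(length L) (L , L! , L-atoms , refl) =
  passages-count , partitionings-count , λ Ps Ps-valid → partitioning-size Ps Ps-valid , atoms≤edges
  where open Atoms E L L! L-atoms
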